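{- For a 2-functor (i.e. locally monotone functor) $T:\mathsf{Pre}\to\mathsf{Pre}$ the following are equivalent: (1) there is a 2-functor $\overline{T}:\mathsf{Rel}(\mathsf{Pre})\to\mathsf{Rel}(\mathsf{Pre})$ with $\overline{T}\circ(-)_\diamond=(-)_\diamond\circ T$; (2) $T$ satisfies the Beck–Chevalley Condition, i.e. $T$ preserves exact squares; (3) there is a distributive law $T\circ\mathbb{L}\to\mathbb{L}\circ T$ of $T$ over the KZ doctrine $(\mathbb{L},\mathbb{y},\mathbb{m})$.
   Context: $\mathsf{Pre}$: preorders, monotone maps, 2-cells $f\le g$ pointwise; $T$ is locally monotone if $f\le g$ implies $Tf\le Tg$. $\mathscr{A}(a,a')\in\{0,1\}$ is the truth value of $a\le a'$, $\mathbb{2}=\{0\le1\}$. $\mathsf{Rel}(\mathsf{Pre})$: objects preorders; 1-cells from $\mathscr{A}$ to $\mathscr{B}$ are monotone maps $R:\mathscr{B}^{op}\times\mathscr{A}\to\mathbb{2}$; composition $(S\cdot R)(c,a)=\bigvee_bR(b,a)\wedge S(c,b)$; identities $(a',a)\mapsto\mathscr{A}(a',a)$; 2-cells pointwise order. $(-)_\diamond:\mathsf{Pre}\to\mathsf{Rel}(\mathsf{Pre})$ is identity on objects and $f_\diamond(b,a)=\mathscr{B}(b,fa)$ for $f:\mathscr{A}\to\mathscr{B}$. A lax square $p_0:\mathscr{P}\to\mathscr{A}$, $p_1:\mathscr{P}\to\mathscr{B}$, $f:\mathscr{A}\to\mathscr{C}$, $g:\mathscr{B}\to\mathscr{C}$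 with $fp_0\le gp_1$ pointwise is exact iff $\mathscr{C}(fa,gb)=\bigvee_w\mathscr{A}(a,p_0w)\wedge\mathscr{B}(p_1w,b)$ for all $a,b$; $T$ preserves exact squares if it maps each exact lax square to an exact (lax) square. The KZ doctrine $(\mathbb{L},\mathbb{y},\mathbb{m})$: $\mathbb{L}\mathscr{A}=[\mathscr{A}^{op},\mathbb{2}]$ is the poset of lowersets of $\mathscr{A}$ ordered by inclusion; for monotone $f:\mathscr{A}\to\mathscr{C}$, $(\mathbb{L}f)(W)=\{c: \exists a\in W,\ c\le fa\}$; $\mathbb{y}_{\mathscr{A}}(a)=\{a':a'\le a\}$; $\mathbb{m}_{\mathscr{A}}(\mathscr{W})=\bigcup_{W\in\mathscr{W}}W$. A distributive law of $T$ over $\mathbb{L}$ is a natural transformation $\lambda:T\mathbb{L}\to\mathbb{L}T$ with $\lambda_{\mathscr{A}}\circ T\mathbb{y}_{\mathscr{A}}=\mathbb{y}_{T\mathscr{A}}$ and $\lambda_{\mathscr{A}}\circ T\mathbb{m}_{\mathscr{A}}=\mathbb{m}_{T\mathscr{A}}\circ\mathbb{L}\lambda_{\mathscr{A}}\circ\lambda_{\mathbb{L}\mathscr{A}}$. -}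

module Defs where

open import Level using (0ℓ)
open import Data.Bool using (Bool; T)
open import Data.Product using (Σ; _×_; _,_; proj₁; proj₂)
open import Function.Bundles using (_⇔_)
open import Relation.Nullary using (Dec; isYes)
open import Relation.Nullary.Decidable using (True; toWitness; fromWitness)
open import Relation.Binary.Bundles using (Preorder)
open import Relation.Binary.Morphism.Bundles using (PreorderHomomorphism)
import Relation.Binary.Morphism.Construct.Identity as MId
import Relation.Binary.Morphism.Construct.Composition as MComp

-- A (small) preorder.  Following the Agda idiom (no quotients), a
-- preorder comes with an underlying equality _≈_ (a setoid); the
-- paper's preorders are the case _≈_ = _≡_.
Pre : Set₁
Pre = Preorder 0ℓ 0ℓ 0ℓ

open Preorder using (Carrier) public

Mono : Pre → Pre → Set
Mono A B = PreorderHomomorphism A B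

app : {A B : Pre} → Mono A B → Carrier A → Carrier B
app f = PreorderHomomorphism.⟦_⟧ f

idM : (A : Pre) → Mono A A
idM A = MId.preorderHomomorphism A

infixr 9 _∘M_
_∘M_ : {A B C : Pre} → Mono B C → Mono A B → Mono A C
g ∘M f = MComp.preorderHomomorphism f g

infix 4 _≐_ _≤M_
_≐_ : {A B : Pre} → Mono A B → Mono A B → Set
_≐_ {A} {B} f g = ∀ a → Preorder._≈_ B (app f a) (app g a)

_≤M_ : {A B : Pre} → Mono A B → Mono A B → Set
_≤M_ {A} {B} f g = ∀ a → Preorder._≲_ B (app f a) (app g a)

record Functor2 : Set₁ where
  field
    F₀     : Pre → Pre
    F₁     : {A B : Pre} → Mono A B → Mono (F₀ A) (F₀ B)
    F-resp : {A B : Pre} {f g : Mono A B} → f ≐ g → F₁ f ≐ F₁ g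
    F-id   : (A : Pre) → F₁ (idM A) ≐ idM (F₀ A)
    F-∘    : {A B C : Pre} (g : Mono B C) (f : Mono A B) →
             F₁ (g ∘M f) ≐ F₁ g ∘M F₁ f
    F-mono : {A B : Pre} {f g : Mono A B} → f ≤M g → F₁ f ≤M F₁ g

-- A 1-cell A ⇸ B: a monotone map  R : B^op × A → 2,
-- represented as a (proof-relevant) truth value  rel b a.
record Rel1 (A B : Pre) : Set₁ where
  field
    rel  : Carrier B → Carrier A → Set
    mono : ∀ {b b' a a'} → Preorder._≲_ B b' b → Preorder._≲_ A a a' →
           rel b a → rel b' a'
open Rel1 public

infix 4 _⊑_ _≅R_
_⊑_ : {A B : Pre} → Rel1 A B → Rel1 A B → Set
R ⊑ S = ∀ b a → rel R b a → rel S b a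

_≅R_ : {A B : Pre} → Rel1 A B → Rel1 A B → Set
R ≅R S = (R ⊑ S) × (S ⊑ R)

idR : (A : Pre) → Rel1 A A
idR A = record
  { rel  = λ a' a → Preorder._≲_ A a' a
  ; mono = λ b'≤b a≤a' b≤a → Preorder.trans A b'≤b (Preorder.trans A b≤a a≤a') }

infixr 9 _·_
_·_ : {A B C : Pre} → Rel1 B C → Rel1 A B → Rel1 A C
_·_ {A} {B} {C} S R = record
  { rel  = λ c a → Σ (Carrier B) (λ b → rel R b a × rel S c b)
  ; mono = λ c'≤c a≤a' → λ { (b , r , s) →
      b , mono R (Preorder.refl B) a≤a' r , mono S c'≤c (Preorder.refl B) s } }

infix 20 _◇
_◇ : {A B : Pre} → Mono A B → Rel1 A B
_◇ {A} {B} f = record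
  { rel  = λ b a → Preorder._≲_ B b (app f a)
  ; mono = λ b'≤b a≤a' b≤fa →
      Preorder.trans B b'≤b (Preorder.trans B b≤fa
        (PreorderHomomorphism.mono f a≤a')) }

-- Condition (1): a 2-functor  T̄ : Rel(Pre) → Rel(Pre)  with
-- T̄ ∘ (-)_◇ = (-)_◇ ∘ T.  On objects this equation forces T̄ A = T A,
-- so the object part of T̄ is taken to be that of T.
record RelExtension (T : Functor2) : Set₁ where
  open Functor2 T
  field
    T̄₁     : {A B : Pre} → Rel1 A B → Rel1 (F₀ A) (F₀ B)
    T̄-mono : {A B : Pre} {R S : Rel1 A B} → R ⊑ S → T̄₁ R ⊑ T̄₁ S
    T̄-id   : (A : Pre) → T̄₁ (idR A) ≅R idR (F₀ A)
    T̄-·    : {A B C : Pre} (S : Rel1 B C) (R : Rel1 A B) →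
             T̄₁ (S · R) ≅R T̄₁ S · T̄₁ R
    T̄-◇    : {A B : Pre} (f : Mono A B) → T̄₁ (f ◇) ≅R (F₁ f) ◇

Lax : {P A B C : Pre} → Mono P A → Mono P B → Mono A C → Mono B C → Set
Lax p₀ p₁ f g = f ∘M p₀ ≤M g ∘M p₁

Exact : {P A B C : Pre} → Mono P A → Mono P B → Mono A C → Mono B C → Set
Exact {P} {A} {B} {C} p₀ p₁ f g =
  ∀ a b → Preorder._≲_ C (app f a) (app g b)
        ⇔ Σ (Carrier P) (λ w → Preorder._≲_ A a (app p₀ w)
                               × Preorder._≲_ B (app p₁ w) b)

BeckChevalley : Functor2 → Set₁
BeckChevalley T =
  {P A B C : Pre} (p₀ : Mono P A) (p₁ : Mono P B) (f : Mono A C) (g : Mono B C) →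
  Lax p₀ p₁ f g → Exact p₀ p₁ f g →
  Exact (F₁ p₀) (F₁ p₁) (F₁ f) (F₁ g)
  where open Functor2 T

-- The KZ doctrine of lowersets (classical: needs a decision oracle so
-- that lowersets, i.e. maps A^op → 2, form a small set)

-- Classical logic for (small) types: the ambient metatheory of the paper.
Classical : Set₁
Classical = (P : Set) → Dec P

module Lowersets (em : Classical) where

  ⟦_⟧? : Set → Bool
  ⟦ P ⟧? = isYes (em P)

  record LowerSet (A : Pre) : Set where
    field
      mem  : Carrier A → Bool
      down : ∀ {x y} → Preorder._≲_ A y x → T (mem x) → T (mem y)
  open LowerSet public

  𝕃 : Pre → Pre
  𝕃 A = record
    { Carrier    = LowerSet A
    ; _≈_        = λ W V → (∀ a → T (mem W a) → T (mem V a))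
                         × (∀ a → T (mem V a) → T (mem W a))
    ; _≲_        = λ W V → ∀ a → T (mem W a) → T (mem V a)
    ; isPreorder = record
      { isEquivalence = record
        { refl  = (λ a x → x) , (λ a x → x)
        ; sym   = λ { (p , q) → q , p }
        ; trans = λ { (p , q) (p' , q') → (λ a x → p' a (p a x))
                                        , (λ a x → q a (q' a x)) } }
      ; reflexive = proj₁
      ; trans     = λ p q a x → q a (p a x) } }

  𝕃₁ : {A C : Pre} → Mono A C → Mono (𝕃 A) (𝕃 C)
  𝕃₁ {A} {C} f = record
    { ⟦_⟧ = img
    ; isOrderHomomorphism = record
      { cong = λ { {W} {V} (p , q) → mon W V p , mon V W q }
      ; mono = λ {W} {V} → mon W V } }
    where
      img : LowerSet A → LowerSet C
      img W = record
        { mem  = λ c → ⟦ Σ (Carrier A) (λ a → T (mem W a)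
                                       × Preorder._≲_ C c (app f a)) ⟧?
        ; down = λ y≤x t → let (a , w , x≤fa) = toWitness t in
                   fromWitness (a , w , Preorder.trans C y≤x x≤fa) }
      mon : ∀ W V → (∀ a → T (mem W a) → T (mem V a)) →
            ∀ c → T (mem (img W) c) → T (mem (img V) c)
      mon W V p c t = let (a , w , c≤fa) = toWitness t in
                  fromWitness (a , p a w , c≤fa)

  𝕪 : (A : Pre) → Mono A (𝕃 A)
  𝕪 A = record
    { ⟦_⟧ = yo
    ; isOrderHomomorphism = record
      { cong = λ x≈y → mon (Preorder.reflexive A x≈y)
                     , mon (Preorder.reflexive A (Preorder.Eq.sym A x≈y))
      ; mono = mon } }
    where
      yo : Carrier A → LowerSet A
      yo a = record
        { mem  = λ a' → ⟦ Preorder._≲_ A a' a ⟧?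
        ; down = λ y≤x t → fromWitness (Preorder.trans A y≤x (toWitness t)) }
      mon : ∀ {x y} → Preorder._≲_ A x y →
            ∀ a → T (mem (yo x) a) → T (mem (yo y) a)
      mon x≤y a t = fromWitness (Preorder.trans A (toWitness t) x≤y)

  𝕞 : (A : Pre) → Mono (𝕃 (𝕃 A)) (𝕃 A)
  𝕞 A = record
    { ⟦_⟧ = un
    ; isOrderHomomorphism = record
      { cong = λ { {𝒲} {𝒱} (p , q) → mon 𝒲 𝒱 p , mon 𝒱 𝒲 q }
      ; mono = λ {𝒲} {𝒱} → mon 𝒲 𝒱 } }
    where
      un : LowerSet (𝕃 A) → LowerSet A
      un 𝒲 = record
        { mem  = λ a → ⟦ Σ (LowerSet A) (λ W → T (mem 𝒲 W) × T (mem W a)) ⟧?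
        ; down = λ y≤x t → let (W , w , x∈W) = toWitness t in
                   fromWitness (W , w , down W y≤x x∈W) }
      mon : ∀ 𝒲 𝒱 → (∀ W → T (mem 𝒲 W) → T (mem 𝒱 W)) →
            ∀ a → T (mem (un 𝒲) a) → T (mem (un 𝒱) a)
      mon 𝒲 𝒱 p a t = let (W , w , a∈W) = toWitness t in
                  fromWitness (W , p W w , a∈W)

  record DistributiveLaw (T : Functor2) : Set₁ where
    open Functor2 T
    field
      λ₀      : (A : Pre) → Mono (F₀ (𝕃 A)) (𝕃 (F₀ A))
      natural : {A B : Pre} (f : Mono A B) →
                λ₀ B ∘M F₁ (𝕃₁ f) ≐ 𝕃₁ (F₁ f) ∘M λ₀ A
      unit    : (A : Pre) → λ₀ A ∘M F₁ (𝕪 A) ≐ 𝕪 (F₀ A)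
      mult    : (A : Pre) →
                λ₀ A ∘M F₁ (𝕞 A) ≐ 𝕞 (F₀ A) ∘M 𝕃₁ (λ₀ A) ∘M λ₀ (𝕃 A)

module Submission where

open import Defs
open import Data.Bool using (T)
open import Data.Product using (_×_; Σ; _,_; proj₁; proj₂)
open import Function.Bundles using (_⇔_; mk⇔; Equivalence)
open import Relation.Nullary.Decidable using (toWitness; fromWitness)
open import Relation.Binary.Bundles using (Preorder)
open import Relation.Binary.Morphism.Bundles using (PreorderHomomorphism)
import Relation.Binary.Reasoning.Setoid as SetoidReasoning

open Equivalence using (to; from)

-- We prove (1) ⇒ (2) ⇒ (1) and (2) ⇒ (3) ⇒ (1).
--
-- T̄ preserves the adjunction f◇ ⊣ f^◇, hence conjoints, hence mates.
-- (2) ⇒ (1): T̄ R := (F tgt)◇ · (F src)^◇ for the tabulation (src , tgt) of R;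
--   BC for comma squares and for a surjection gives functoriality of T̄.
-- (2) ⇒ (3): λ_A X := { t | F 𝕪 t ≤ X }; the unit, naturality and
--   multiplication laws are BC for three exact squares built from 𝕪, 𝕃 f, 𝕞.
-- (3) ⇒ (1): a relation R : A ⇸ B is a monotone map ρ R : A → 𝕃 B, and
--   T̄ R := λ_B ∘ F (ρ R); the laws of λ translate into functoriality of T̄.
-- In both constructions of T̄ preservation of identities is automatic
-- (mkRelExtension), since idR A is (idM A)◇.

le : (A : Pre) → Carrier A → Carrier A → Set
le A x y = Preorder._≲_ A x y

syntax le A x y = x ≤[ A ] y

≤-refl : (A : Pre) {x : Carrier A} → x ≤[ A ] x
≤-refl A = Preorder.refl A

≤-trans : (A : Pre) {x y z : Carrier A} → x ≤[ A ] y → y ≤[ A ] z → x ≤[ A ] z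
≤-trans A = Preorder.trans A

≈⇒≤ : (A : Pre) {x y : Carrier A} → Preorder._≈_ A x y → x ≤[ A ] y
≈⇒≤ A = Preorder.reflexive A

≈⇒≥ : (A : Pre) {x y : Carrier A} → Preorder._≈_ A x y → y ≤[ A ] x
≈⇒≥ A x≈y = Preorder.reflexive A (Preorder.Eq.sym A x≈y)

monotone : {A B : Pre} (f : Mono A B) {x y : Carrier A} →
           x ≤[ A ] y → app f x ≤[ B ] app f y
monotone f = PreorderHomomorphism.mono f

resp : {A B : Pre} (f : Mono A B) {x y : Carrier A} →
       Preorder._≈_ A x y → Preorder._≈_ B (app f x) (app f y)
resp f = PreorderHomomorphism.cong f

mkMono : {A B : Pre} (f : Carrier A → Carrier B) →
         (∀ {x y} → Preorder._≈_ A x y → Preorder._≈_ B (f x) (f y)) →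
         (∀ {x y} → x ≤[ A ] y → f x ≤[ B ] f y) → Mono A B
mkMono f c m = record { ⟦_⟧ = f ; isOrderHomomorphism = record { cong = c ; mono = m } }

Induced : (X : Set) (A : Pre) → (X → Carrier A) → Pre
Induced X A key = record
  { Carrier    = X
  ; _≈_        = λ x y → Preorder._≈_ A (key x) (key y)
  ; _≲_        = λ x y → key x ≤[ A ] key y
  ; isPreorder = record
    { isEquivalence = record
      { refl  = Preorder.Eq.refl A
      ; sym   = Preorder.Eq.sym A
      ; trans = Preorder.Eq.trans A }
    ; reflexive = Preorder.reflexive A
    ; trans     = Preorder.trans A } }

infixr 2 _×P_
_×P_ : Pre → Pre → Pre
A ×P B = record
  { Carrier    = Carrier A × Carrier B
  ; _≈_        = λ x y → Preorder._≈_ A (proj₁ x) (proj₁ y) × Preorder._≈_ B (proj₂ x) (proj₂ y)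
  ; _≲_        = λ x y → proj₁ x ≤[ A ] proj₁ y × proj₂ x ≤[ B ] proj₂ y
  ; isPreorder = record
    { isEquivalence = record
      { refl  = Preorder.Eq.refl A , Preorder.Eq.refl B
      ; sym   = λ (p , q) → Preorder.Eq.sym A p , Preorder.Eq.sym B q
      ; trans = λ (p , q) (p' , q') → Preorder.Eq.trans A p p' , Preorder.Eq.trans B q q' }
    ; reflexive = λ (p , q) → ≈⇒≤ A p , ≈⇒≤ B q
    ; trans     = λ (p , q) (p' , q') → ≤-trans A p p' , ≤-trans B q q' } }

lax-witness : {P A B C : Pre} (p₀ : Mono P A) (p₁ : Mono P B) (f : Mono A C) (g : Mono B C) →
              Lax p₀ p₁ f g → ∀ {a b} →
              Σ (Carrier P) (λ w → a ≤[ A ] app p₀ w × app p₁ w ≤[ B ] b) →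
              app f a ≤[ C ] app g b
lax-witness {C = C} p₀ p₁ f g lax (w , a≤p₀w , p₁w≤b) =
  ≤-trans C (monotone f a≤p₀w) (≤-trans C (lax w) (monotone g p₁w≤b))

Comma : {A B C : Pre} → Mono A C → Mono B C → Pre
Comma {A} {B} {C} f g =
  Induced (Σ (Carrier A) λ a → Σ (Carrier B) λ b → app f a ≤[ C ] app g b)
          (A ×P B) (λ w → proj₁ w , proj₁ (proj₂ w))

comma₀ : {A B C : Pre} (f : Mono A C) (g : Mono B C) → Mono (Comma f g) A
comma₀ f g = mkMono proj₁ proj₁ proj₁

comma₁ : {A B C : Pre} (f : Mono A C) (g : Mono B C) → Mono (Comma f g) B
comma₁ f g = mkMono (λ w → proj₁ (proj₂ w)) proj₂ proj₂

comma-lax : {A B C : Pre} (f : Mono A C) (g : Mono B C) →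
            Lax (comma₀ f g) (comma₁ f g) f g
comma-lax f g w = proj₂ (proj₂ w)

comma-exact : {A B C : Pre} (f : Mono A C) (g : Mono B C) →
              Exact (comma₀ f g) (comma₁ f g) f g
comma-exact {A} {B} f g a b =
  mk⇔ (λ fa≤gb → (a , b , fa≤gb) , ≤-refl A , ≤-refl B)
      (lax-witness (comma₀ f g) (comma₁ f g) f g (comma-lax f g))

-- Chains of inclusions.  The record keeps the endpoints of each step visible
-- to the type checker (R ⊑ S itself unfolds to a Π-type).
record _⊑*_ {A B : Pre} (R S : Rel1 A B) : Set where
  constructor chain
  field included : R ⊑ S
open _⊑*_

infixr 2 _⊑⟨_⟩_
infix  3 _∎⊑

_⊑⟨_⟩_ : {A B : Pre} (R : Rel1 A B) {S U : Rel1 A B} → R ⊑ S → S ⊑* U → R ⊑* U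
R ⊑⟨ R⊑S ⟩ chain S⊑U = chain (λ b a r → S⊑U b a (R⊑S b a r))

_∎⊑ : {A B : Pre} (R : Rel1 A B) → R ⊑* R
R ∎⊑ = chain (λ b a r → r)

·-mono : {A B C : Pre} {S S' : Rel1 B C} {R R' : Rel1 A B} →
         S ⊑ S' → R ⊑ R' → (S · R) ⊑ (S' · R')
·-mono S⊑S' R⊑R' c a (b , r , s) = b , R⊑R' b a r , S⊑S' c b s

infix 20 _^◇
_^◇ : {A B : Pre} → Mono A B → Rel1 B A
_^◇ {A} {B} f = record
  { rel  = λ a b → app f a ≤[ B ] b
  ; mono = λ a'≤a b≤b' fa≤b → ≤-trans B (monotone f a'≤a) (≤-trans B fa≤b b≤b') }

conj-unit : {A B : Pre} (f : Mono A B) → idR A ⊑ (f ^◇ · f ◇)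
conj-unit {B = B} f a' a a'≤a = app f a , ≤-refl B , monotone f a'≤a

conj-counit : {A B : Pre} (f : Mono A B) → (f ◇ · f ^◇) ⊑ idR B
conj-counit {B = B} f b' b (a , fa≤b , b'≤fa) = ≤-trans B b'≤fa fa≤b

◇-identity : {A : Pre} (f : Mono A A) → f ≐ idM A → f ◇ ≅R idR A
◇-identity {A} f f≐id =
    (λ b a b≤fa → ≤-trans A b≤fa (≈⇒≤ A (f≐id a)))
  , (λ b a b≤a → ≤-trans A b≤a (≈⇒≥ A (f≐id a)))

exact⇒mate : {P A B C : Pre} (p₀ : Mono P A) (p₁ : Mono P B) (f : Mono A C) (g : Mono B C) →
             Exact p₀ p₁ f g → (f ^◇ · g ◇) ⊑ (p₀ ◇ · p₁ ^◇)
exact⇒mate {C = C} p₀ p₁ f g ex a b (c , c≤gb , fa≤c) =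
  let (w , a≤p₀w , p₁w≤b) = to (ex a b) (≤-trans C fa≤c c≤gb) in w , p₁w≤b , a≤p₀w

mate⇒exact : {P A B C : Pre} (p₀ : Mono P A) (p₁ : Mono P B) (f : Mono A C) (g : Mono B C) →
             Lax p₀ p₁ f g → (f ^◇ · g ◇) ⊑ (p₀ ◇ · p₁ ^◇) → Exact p₀ p₁ f g
mate⇒exact {P} {A} {B} {C} p₀ p₁ f g lax mate a b = mk⇔ forward (lax-witness p₀ p₁ f g lax)
  where
    forward : app f a ≤[ C ] app g b →
              Σ (Carrier P) λ w → a ≤[ A ] app p₀ w × app p₁ w ≤[ B ] b
    forward fa≤gb =
      let (w , p₁w≤b , a≤p₀w) = mate a b (app g b , ≤-refl C , fa≤gb) in w , a≤p₀w , p₁w≤b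

Tab : {A B : Pre} → Rel1 A B → Pre
Tab {A} {B} R = Induced (Σ (Carrier B) λ b → Σ (Carrier A) λ a → rel R b a)
                        (B ×P A) (λ w → proj₁ w , proj₁ (proj₂ w))

tgt : {A B : Pre} (R : Rel1 A B) → Mono (Tab R) B
tgt R = mkMono proj₁ proj₁ proj₁

src : {A B : Pre} (R : Rel1 A B) → Mono (Tab R) A
src R = mkMono (λ w → proj₁ (proj₂ w)) proj₂ proj₂

module FunctorLemmas (F : Functor2) where
  open Functor2 F

  F-id≤ : {A : Pre} (x : Carrier (F₀ A)) → app (F₁ (idM A)) x ≤[ F₀ A ] x
  F-id≤ {A} x = ≈⇒≤ (F₀ A) (F-id A x)

  F-id≥ : {A : Pre} (x : Carrier (F₀ A)) → x ≤[ F₀ A ] app (F₁ (idM A)) x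
  F-id≥ {A} x = ≈⇒≥ (F₀ A) (F-id A x)

  F-∘≤ : {A B C : Pre} (g : Mono B C) (f : Mono A B) (k : Mono A C) → g ∘M f ≤M k →
         F₁ g ∘M F₁ f ≤M F₁ k
  F-∘≤ {C = C} g f k gf≤k x = ≤-trans (F₀ C) (≈⇒≥ (F₀ C) (F-∘ g f x)) (F-mono gf≤k x)

  F-≤∘ : {A B C : Pre} (g : Mono B C) (f : Mono A B) (k : Mono A C) → k ≤M g ∘M f →
         F₁ k ≤M F₁ g ∘M F₁ f
  F-≤∘ {C = C} g f k k≤gf x = ≤-trans (F₀ C) (F-mono k≤gf x) (≈⇒≤ (F₀ C) (F-∘ g f x))

  F-lax : {P A B C : Pre} (p₀ : Mono P A) (p₁ : Mono P B) (f : Mono A C) (g : Mono B C) →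
          Lax p₀ p₁ f g → Lax (F₁ p₀) (F₁ p₁) (F₁ f) (F₁ g)
  F-lax {C = C} p₀ p₁ f g lax x =
    ≤-trans (F₀ C) (F-∘≤ f p₀ (g ∘M p₁) lax x) (F-≤∘ g p₁ (g ∘M p₁) (λ _ → ≤-refl C) x)

  F-∘₃ : {A B C D : Pre} (h : Mono C D) (g : Mono B C) (f : Mono A B) →
         F₁ (h ∘M g ∘M f) ≐ F₁ h ∘M F₁ g ∘M F₁ f
  F-∘₃ {D = D} h g f x = Preorder.Eq.trans (F₀ D) (F-∘ h (g ∘M f) x) (resp (F₁ h) (F-∘ g f x))

-- An extension only has to be checked to be monotone and to preserve
-- composition and (-)◇: identities are then preserved since idR A ≅ (idM A)◇.
mkRelExtension :
  (F : Functor2) (let open Functor2 F)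
  (T̄₁ : {A B : Pre} → Rel1 A B → Rel1 (F₀ A) (F₀ B)) →
  ({A B : Pre} {R S : Rel1 A B} → R ⊑ S → T̄₁ R ⊑ T̄₁ S) →
  ({A B C : Pre} (S : Rel1 B C) (R : Rel1 A B) → T̄₁ (S · R) ≅R T̄₁ S · T̄₁ R) →
  ({A B : Pre} (f : Mono A B) → T̄₁ (f ◇) ≅R F₁ f ◇) →
  RelExtension F
mkRelExtension F T̄₁ T̄-mono T̄-· T̄-◇ = record
  { T̄₁ = T̄₁ ; T̄-mono = T̄-mono ; T̄-id = T̄-id ; T̄-· = T̄-· ; T̄-◇ = T̄-◇ }
  where
    open Functor2 F
    T̄-id : (A : Pre) → T̄₁ (idR A) ≅R idR (F₀ A)
    T̄-id A =
        included
          (T̄₁ (idR A)    ⊑⟨ T̄-mono (proj₂ (◇-identity (idM A) (λ _ → Preorder.Eq.refl A))) ⟩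
           T̄₁ (idM A ◇)  ⊑⟨ proj₁ (T̄-◇ (idM A)) ⟩
           F₁ (idM A) ◇  ⊑⟨ proj₁ (◇-identity (F₁ (idM A)) (F-id A)) ⟩
           idR (F₀ A)    ∎⊑)
      , included
          (idR (F₀ A)    ⊑⟨ proj₂ (◇-identity (F₁ (idM A)) (F-id A)) ⟩
           F₁ (idM A) ◇  ⊑⟨ proj₂ (T̄-◇ (idM A)) ⟩
           T̄₁ (idM A ◇)  ⊑⟨ T̄-mono (proj₁ (◇-identity (idM A) (λ _ → Preorder.Eq.refl A))) ⟩
           T̄₁ (idR A)    ∎⊑)

module ExtensionToBC (F : Functor2) (E : RelExtension F) where
  open Functor2 F
  open RelExtension E
  open FunctorLemmas F

  -- T̄ preserves the adjunction f◇ ⊣ f^◇, hence maps the conjoint of f to that of F f.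
  T̄-conj : {A B : Pre} (f : Mono A B) → T̄₁ (f ^◇) ≅R F₁ f ^◇
  T̄-conj {A} {B} f = T̄f^⊑ , ⊑T̄f^
    where
      T̄f^⊑ : T̄₁ (f ^◇) ⊑ F₁ f ^◇
      T̄f^⊑ x y r =
        proj₁ (T̄-id B) _ _ (T̄-mono (conj-counit f) _ _
          (proj₂ (T̄-· (f ◇) (f ^◇)) _ _ (x , r , proj₂ (T̄-◇ f) _ _ (≤-refl (F₀ B)))))
      ⊑T̄f^ : F₁ f ^◇ ⊑ T̄₁ (f ^◇)
      ⊑T̄f^ x y Ffx≤y =
        let (z , r◇ , r^) = proj₁ (T̄-· (f ^◇) (f ◇)) _ _
                              (T̄-mono (conj-unit f) _ _ (proj₂ (T̄-id A) _ _ (≤-refl (F₀ A))))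
        in mono (T̄₁ (f ^◇)) (≤-refl (F₀ A)) (≤-trans (F₀ B) (proj₁ (T̄-◇ f) _ _ r◇) Ffx≤y) r^

  -- The mate of an exact square is transported by T̄ to the mate of its F-image.
  extension⇒BC : BeckChevalley F
  extension⇒BC p₀ p₁ f g lax ex =
    mate⇒exact (F₁ p₀) (F₁ p₁) (F₁ f) (F₁ g) (F-lax p₀ p₁ f g lax) (included
      (F₁ f ^◇ · F₁ g ◇        ⊑⟨ ·-mono {S = F₁ f ^◇} {T̄₁ (f ^◇)} {F₁ g ◇} {T̄₁ (g ◇)}
                                          (proj₂ (T̄-conj f)) (proj₂ (T̄-◇ g)) ⟩
       T̄₁ (f ^◇) · T̄₁ (g ◇)    ⊑⟨ proj₂ (T̄-· (f ^◇) (g ◇)) ⟩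
       T̄₁ (f ^◇ · g ◇)         ⊑⟨ T̄-mono (exact⇒mate p₀ p₁ f g ex) ⟩
       T̄₁ (p₀ ◇ · p₁ ^◇)       ⊑⟨ proj₁ (T̄-· (p₀ ◇) (p₁ ^◇)) ⟩
       T̄₁ (p₀ ◇) · T̄₁ (p₁ ^◇)  ⊑⟨ ·-mono {S = T̄₁ (p₀ ◇)} {F₁ p₀ ◇} {T̄₁ (p₁ ^◇)} {F₁ p₁ ^◇}
                                          (proj₁ (T̄-◇ p₀)) (proj₁ (T̄-conj p₁)) ⟩
       F₁ p₀ ◇ · F₁ p₁ ^◇      ∎⊑))

module BCLemmas (F : Functor2) (bc : BeckChevalley F) where
  open Functor2 F
  open FunctorLemmas F

  -- F preserves order-reflecting maps, because f reflects the order iff the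
  -- square (id , id , f , f) is exact.
  F-reflects : {A B : Pre} (f : Mono A B) →
               (∀ {a a'} → app f a ≤[ B ] app f a' → a ≤[ A ] a') →
               ∀ {x x'} → app (F₁ f) x ≤[ F₀ B ] app (F₁ f) x' → x ≤[ F₀ A ] x'
  F-reflects {A} {B} f reflects {x} {x'} Ffx≤Ffx' =
    let (w , x≤w , w≤x') = to (bc (idM A) (idM A) f f (λ _ → ≤-refl B) ex x x') Ffx≤Ffx'
    in ≤-trans (F₀ A) x≤w (≤-trans (F₀ A) (F-id≤ w) (≤-trans (F₀ A) (F-id≥ w) w≤x'))
    where
      ex : Exact (idM A) (idM A) f f
      ex a a' = mk⇔ (λ fa≤fa' → a , ≤-refl A , reflects fa≤fa')
                    (lax-witness (idM A) (idM A) f f (λ _ → ≤-refl B))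

  F-comma-exact : {A B C : Pre} (f : Mono A C) (g : Mono B C) →
                  Exact (F₁ (comma₀ f g)) (F₁ (comma₁ f g)) (F₁ f) (F₁ g)
  F-comma-exact f g = bc (comma₀ f g) (comma₁ f g) f g (comma-lax f g) (comma-exact f g)

  -- F preserves maps k that are surjective up to equivalence, because for
  -- such k the square (k , k , id , id) is exact.
  F-surjective : {Q P : Pre} (k : Mono Q P) →
                 (∀ e → Σ (Carrier Q) λ w → e ≤[ P ] app k w × app k w ≤[ P ] e) →
                 ∀ u → Σ (Carrier (F₀ Q)) λ w → u ≤[ F₀ P ] app (F₁ k) w × app (F₁ k) w ≤[ F₀ P ] u
  F-surjective {Q} {P} k surjective u =
    to (bc k k (idM P) (idM P) (λ _ → ≤-refl P) ex u u) (≤-refl (F₀ P))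
    where
      ex : Exact k k (idM P) (idM P)
      ex e e' = mk⇔ (λ e≤e' → let (w , e≤kw , kw≤e) = surjective e
                              in w , e≤kw , ≤-trans P kw≤e e≤e')
                    (lax-witness k k (idM P) (idM P) (λ _ → ≤-refl P))

-- The tabulation of S · R, additionally ordered by the middle witness b,
-- with its projections.  Forgetting the extra order is a surjection.
module Witnessed {A B C : Pre} (S : Rel1 B C) (R : Rel1 A B) where

  Wit : Pre
  Wit = Induced (Carrier (Tab (S · R))) (C ×P A ×P B)
                (λ (c , a , b , _) → c , a , b)

  forget : Mono Wit (Tab (S · R))
  forget = mkMono (λ w → w) (λ (c≈ , a≈ , _) → c≈ , a≈) (λ (c≤ , a≤ , _) → c≤ , a≤)

  middle : Mono Wit B
  middle = mkMono (λ (_ , _ , b , _) → b) (λ (_ , _ , b≈) → b≈) (λ (_ , _ , b≤) → b≤)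

  πR : Mono Wit (Tab R)
  πR = mkMono (λ (_ , a , b , r , _) → b , a , r)
              (λ (_ , a≈ , b≈) → b≈ , a≈) (λ (_ , a≤ , b≤) → b≤ , a≤)

  πS : Mono Wit (Tab S)
  πS = mkMono (λ (c , _ , b , _ , s) → c , b , s)
              (λ (c≈ , _ , b≈) → c≈ , b≈) (λ (c≤ , _ , b≤) → c≤ , b≤)

glue : {A B C : Pre} (S : Rel1 B C) (R : Rel1 A B) →
       Mono (Comma (src S) (tgt R)) (Tab (S · R))
glue {C = C} S R =
  mkMono (λ ((c , _ , s) , (b , a , r) , b'≤b) → c , a , b , r , mono S (≤-refl C) b'≤b s)
         (λ ((c≈ , _) , (_ , a≈)) → c≈ , a≈) (λ ((c≤ , _) , (_ , a≤)) → c≤ , a≤)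

module BCToExtension (F : Functor2) (bc : BeckChevalley F) where
  open Functor2 F
  open FunctorLemmas F
  open BCLemmas F bc

  T̄₁ : {A B : Pre} → Rel1 A B → Rel1 (F₀ A) (F₀ B)
  T̄₁ R = F₁ (tgt R) ◇ · F₁ (src R) ^◇

  T̄-mono : {A B : Pre} {R S : Rel1 A B} → R ⊑ S → T̄₁ R ⊑ T̄₁ S
  T̄-mono {A} {B} {R} {S} R⊑S y x (e , Fsrc≤x , y≤Ftgt) =
      app (F₁ incl) e
    , ≤-trans (F₀ A) (F-∘≤ (src S) incl (src R) (λ _ → ≤-refl A) e) Fsrc≤x
    , ≤-trans (F₀ B) y≤Ftgt (F-≤∘ (tgt S) incl (tgt R) (λ _ → ≤-refl B) e)
    where
      incl : Mono (Tab R) (Tab S)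
      incl = mkMono (λ (b , a , r) → b , a , R⊑S b a r) (λ e≈ → e≈) (λ e≤ → e≤)

  -- The tabulation of f◇ is the comma object  id ↓ f, whose square is exact.
  T̄-◇ : {A B : Pre} (f : Mono A B) → T̄₁ (f ◇) ≅R F₁ f ◇
  T̄-◇ {A} {B} f = T̄f◇⊑ , ⊑T̄f◇
    where
      T̄f◇⊑ : T̄₁ (f ◇) ⊑ F₁ f ◇
      T̄f◇⊑ y x (e , Fsrc≤x , y≤Ftgt) =
        ≤-trans (F₀ B) y≤Ftgt
          (≤-trans (F₀ B) (F-≤∘ f (src (f ◇)) (tgt (f ◇)) (comma-lax (idM B) f) e)
                          (monotone (F₁ f) Fsrc≤x))
      ⊑T̄f◇ : F₁ f ◇ ⊑ T̄₁ (f ◇)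
      ⊑T̄f◇ y x y≤Ffx =
        let (e , y≤Ftgt , Fsrc≤x) =
              to (F-comma-exact (idM B) f y x) (≤-trans (F₀ B) (F-id≤ y) y≤Ffx)
        in e , Fsrc≤x , y≤Ftgt

  module _ {A B C : Pre} (S : Rel1 B C) (R : Rel1 A B) where
    open Witnessed S R

    -- A witness u for T̄ (S · R) lifts to F Wit, and its middle point
    -- witnesses the composite T̄ S · T̄ R.
    T̄-·⊑ : T̄₁ (S · R) ⊑ T̄₁ S · T̄₁ R
    T̄-·⊑ z x (u , Fsrc≤x , z≤Ftgt) =
      let (w , u≤Fw , Fw≤u) =
            F-surjective forget (λ e → e , (≤-refl C , ≤-refl A) , (≤-refl C , ≤-refl A)) u
      in  app (F₁ middle) w
        , ( app (F₁ πR) w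
          , ≤-trans (F₀ A) (F-lax πR forget (src R) (src (S · R)) (λ _ → ≤-refl A) w)
                           (≤-trans (F₀ A) (monotone (F₁ (src (S · R))) Fw≤u) Fsrc≤x)
          , F-≤∘ (tgt R) πR middle (λ _ → ≤-refl B) w )
        , ( app (F₁ πS) w
          , F-∘≤ (src S) πS middle (λ _ → ≤-refl B) w
          , ≤-trans (F₀ C) z≤Ftgt
              (≤-trans (F₀ C) (monotone (F₁ (tgt (S · R))) u≤Fw)
                              (F-lax forget πS (tgt (S · R)) (tgt S) (λ _ → ≤-refl C) w)) )

    -- Witnesses for T̄ S and T̄ R meeting in the middle glue, by BC for the
    -- comma square of src S and tgt R, to a witness for T̄ (S · R).
    T̄-·⊒ : T̄₁ S · T̄₁ R ⊑ T̄₁ (S · R)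
    T̄-·⊒ z x (y , (e , FsrcR≤x , y≤FtgtR) , (d , FsrcS≤y , z≤FtgtS)) =
      let (w , d≤Fπ₀w , Fπ₁w≤e) =
            to (F-comma-exact (src S) (tgt R) d e) (≤-trans (F₀ B) FsrcS≤y y≤FtgtR)
      in  app (F₁ (glue S R)) w
        , ≤-trans (F₀ A) (F-lax (glue S R) π₁ (src (S · R)) (src R) (λ _ → ≤-refl A) w)
                         (≤-trans (F₀ A) (monotone (F₁ (src R)) Fπ₁w≤e) FsrcR≤x)
        , ≤-trans (F₀ C) z≤FtgtS
            (≤-trans (F₀ C) (monotone (F₁ (tgt S)) d≤Fπ₀w)
                            (F-lax π₀ (glue S R) (tgt S) (tgt (S · R)) (λ _ → ≤-refl C) w))
      where
        π₀ : Mono (Comma (src S) (tgt R)) (Tab S)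
        π₀ = comma₀ (src S) (tgt R)
        π₁ : Mono (Comma (src S) (tgt R)) (Tab R)
        π₁ = comma₁ (src S) (tgt R)

  BC⇒extension : RelExtension F
  BC⇒extension = mkRelExtension F T̄₁ (λ {A} {B} {R} {S} → T̄-mono {A} {B} {R} {S})
                   (λ S R → T̄-·⊑ S R , T̄-·⊒ S R) T̄-◇

module LowersetLemmas (em : Classical) where
  open Lowersets em

  infix 4 _∈_
  _∈_ : {A : Pre} → Carrier A → LowerSet A → Set
  a ∈ W = T (mem W a)

  sound : {P : Set} → T ⟦ P ⟧? → P
  sound = toWitness

  complete : {P : Set} → P → T ⟦ P ⟧?
  complete = fromWitness

  ∈𝕪-elim : (A : Pre) (a : Carrier A) {a' : Carrier A} → a' ∈ app (𝕪 A) a → a' ≤[ A ] a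
  ∈𝕪-elim A a = sound

  ∈𝕪-intro : (A : Pre) (a : Carrier A) {a' : Carrier A} → a' ≤[ A ] a → a' ∈ app (𝕪 A) a
  ∈𝕪-intro A a = complete

  ∈𝕃-elim : {A C : Pre} (f : Mono A C) (W : LowerSet A) {c : Carrier C} →
            c ∈ app (𝕃₁ f) W → Σ (Carrier A) λ a → a ∈ W × c ≤[ C ] app f a
  ∈𝕃-elim f W = sound

  ∈𝕃-intro : {A C : Pre} (f : Mono A C) (W : LowerSet A) {c : Carrier C} →
             (Σ (Carrier A) λ a → a ∈ W × c ≤[ C ] app f a) → c ∈ app (𝕃₁ f) W
  ∈𝕃-intro f W = complete

  ∈𝕞-elim : (A : Pre) (𝒲 : LowerSet (𝕃 A)) {a : Carrier A} →
            a ∈ app (𝕞 A) 𝒲 → Σ (LowerSet A) λ W → W ∈ 𝒲 × a ∈ W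
  ∈𝕞-elim A 𝒲 = sound

  ∈𝕞-intro : (A : Pre) (𝒲 : LowerSet (𝕃 A)) {a : Carrier A} →
             (Σ (LowerSet A) λ W → W ∈ 𝒲 × a ∈ W) → a ∈ app (𝕞 A) 𝒲
  ∈𝕞-intro A 𝒲 = complete

  𝕪-reflects : {A : Pre} {a a' : Carrier A} →
               app (𝕪 A) a ≤[ 𝕃 A ] app (𝕪 A) a' → a ≤[ A ] a'
  𝕪-reflects {A} {a} {a'} 𝕪a≤𝕪a' = ∈𝕪-elim A a' (𝕪a≤𝕪a' a (∈𝕪-intro A a (≤-refl A)))

  𝕞-𝕪-unit : {A : Pre} → idM (𝕃 A) ≤M 𝕞 A ∘M 𝕪 (𝕃 A)
  𝕞-𝕪-unit {A} V a a∈V =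
    ∈𝕞-intro A (app (𝕪 (𝕃 A)) V) (V , ∈𝕪-intro (𝕃 A) V {V} (λ _ a'∈V → a'∈V) , a∈V)

  ∈-𝕞𝕃-elim : {X C : Pre} (h : Mono X (𝕃 C)) {V : LowerSet X} {z : Carrier C} →
              z ∈ app (𝕞 C) (app (𝕃₁ h) V) → Σ (Carrier X) λ x → x ∈ V × z ∈ app h x
  ∈-𝕞𝕃-elim {C = C} h {V} {z} z∈ =
    let (W , W∈ , z∈W) = ∈𝕞-elim C (app (𝕃₁ h) V) z∈
        (x , x∈V , W≤hx) = ∈𝕃-elim h V {W} W∈
    in x , x∈V , W≤hx z z∈W

  ∈-𝕞𝕃-intro : {X C : Pre} (h : Mono X (𝕃 C)) {V : LowerSet X} {z : Carrier C} →
               (Σ (Carrier X) λ x → x ∈ V × z ∈ app h x) → z ∈ app (𝕞 C) (app (𝕃₁ h) V)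
  ∈-𝕞𝕃-intro {C = C} h {V} (x , x∈V , z∈hx) =
    ∈𝕞-intro C (app (𝕃₁ h) V) (app h x , ∈𝕃-intro h V {app h x} (x , x∈V , ≤-refl (𝕃 C) {app h x}) , z∈hx)

  ∈-𝕞𝕃𝕃-elim : {X Y C : Pre} (h : Mono Y (𝕃 C)) (g : Mono X Y) {V : LowerSet X} {z : Carrier C} →
               z ∈ app (𝕞 C) (app (𝕃₁ h) (app (𝕃₁ g) V)) →
               Σ (Carrier X) λ x → x ∈ V × z ∈ app h (app g x)
  ∈-𝕞𝕃𝕃-elim h g {V} {z} z∈ =
    let (y , y∈ , z∈hy) = ∈-𝕞𝕃-elim h {app (𝕃₁ g) V} z∈
        (x , x∈V , y≤gx) = ∈𝕃-elim g V {y} y∈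
    in x , x∈V , monotone h y≤gx z z∈hy

  ∈-𝕞𝕃𝕃-intro : {X Y C : Pre} (h : Mono Y (𝕃 C)) (g : Mono X Y) {V : LowerSet X} {z : Carrier C} →
                (Σ (Carrier X) λ x → x ∈ V × z ∈ app h (app g x)) →
                z ∈ app (𝕞 C) (app (𝕃₁ h) (app (𝕃₁ g) V))
  ∈-𝕞𝕃𝕃-intro {Y = Y} h g {V} (x , x∈V , z∈hgx) =
    ∈-𝕞𝕃-intro h {app (𝕃₁ g) V} (app g x , ∈𝕃-intro g V (x , x∈V , ≤-refl Y {app g x}) , z∈hgx)

  𝕃-lax : {A B : Pre} (f : Mono A B) → Lax f (𝕪 A) (𝕪 B) (𝕃₁ f)
  𝕃-lax {A} {B} f a b b≤fa =
    ∈𝕃-intro f (app (𝕪 A) a) (a , ∈𝕪-intro A a (≤-refl A) , ∈𝕪-elim B (app f a) b≤fa)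

  𝕃-exact : {A B : Pre} (f : Mono A B) → Exact f (𝕪 A) (𝕪 B) (𝕃₁ f)
  𝕃-exact {A} {B} f b W =
    mk⇔ forward (lax-witness f (𝕪 A) (𝕪 B) (𝕃₁ f) (𝕃-lax f) {b} {W})
    where
      forward : app (𝕪 B) b ≤[ 𝕃 B ] app (𝕃₁ f) W →
                Σ (Carrier A) λ a → b ≤[ B ] app f a × app (𝕪 A) a ≤[ 𝕃 A ] W
      forward 𝕪b≤𝕃fW =
        let (a , a∈W , b≤fa) = ∈𝕃-elim f W (𝕪b≤𝕃fW b (∈𝕪-intro B b (≤-refl B)))
        in a , b≤fa , λ a' a'≤a → down W (∈𝕪-elim A a a'≤a) a∈W

  Elem : Pre → Pre
  Elem A = Induced (Σ (Carrier A) λ a → Σ (LowerSet A) λ W → a ∈ W)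
                   (A ×P 𝕃 A) (λ (a , W , _) → a , W)

  element : {A : Pre} → Mono (Elem A) A
  element = mkMono proj₁ proj₁ proj₁

  set : {A : Pre} → Mono (Elem A) (𝕃 A)
  set = mkMono (λ (_ , W , _) → W) proj₂ proj₂

  𝕪-element≤set : {A : Pre} → 𝕪 A ∘M element ≤M set
  𝕪-element≤set {A} (a , W , a∈W) a' a'≤a = down W (∈𝕪-elim A a a'≤a) a∈W

  Elem-lax : (A : Pre) → Lax element (𝕪 (𝕃 A) ∘M set) (𝕪 A) (𝕞 A)
  Elem-lax A w a' a'≤a = 𝕞-𝕪-unit {A} (app set w) a' (𝕪-element≤set {A} w a' a'≤a)

  Elem-exact : (A : Pre) → Exact element (𝕪 (𝕃 A) ∘M set) (𝕪 A) (𝕞 A)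
  Elem-exact A a 𝒲 =
    mk⇔ forward (lax-witness element (𝕪 (𝕃 A) ∘M set) (𝕪 A) (𝕞 A) (Elem-lax A) {a} {𝒲})
    where
      forward : app (𝕪 A) a ≤[ 𝕃 A ] app (𝕞 A) 𝒲 →
                Σ (Carrier (Elem A)) λ w → a ≤[ A ] app element w
                                         × app (𝕪 (𝕃 A) ∘M set) w ≤[ 𝕃 (𝕃 A) ] 𝒲
      forward 𝕪a≤𝕞𝒲 =
        let (W , W∈𝒲 , a∈W) = ∈𝕞-elim A 𝒲 (𝕪a≤𝕞𝒲 a (∈𝕪-intro A a (≤-refl A)))
        in (a , W , a∈W) , ≤-refl A , λ V V≤W → down 𝒲 (∈𝕪-elim (𝕃 A) W {V} V≤W) W∈𝒲

  column : {A B : Pre} → Rel1 A B → Carrier A → LowerSet B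
  column {A} R a = record
    { mem  = λ b → ⟦ rel R b a ⟧?
    ; down = λ b'≤b b∈ → complete (mono R b'≤b (≤-refl A) (sound b∈)) }

  ∈ρ-elim : {A B : Pre} (R : Rel1 A B) (a : Carrier A) {b : Carrier B} →
            b ∈ column R a → rel R b a
  ∈ρ-elim R a = sound

  ∈ρ-intro : {A B : Pre} (R : Rel1 A B) (a : Carrier A) {b : Carrier B} →
             rel R b a → b ∈ column R a
  ∈ρ-intro R a = complete

  ρ : {A B : Pre} → Rel1 A B → Mono A (𝕃 B)
  ρ {A} {B} R = mkMono (column R) (λ a≈a' → shift (≈⇒≤ A a≈a') , shift (≈⇒≥ A a≈a')) shift
    where
      shift : ∀ {a a'} → a ≤[ A ] a' → column R a ≤[ 𝕃 B ] column R a'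
      shift {a} {a'} a≤a' b b∈ = ∈ρ-intro R a' (mono R (≤-refl B) a≤a' (∈ρ-elim R a b∈))

  toRel : {A B : Pre} → Mono A (𝕃 B) → Rel1 A B
  toRel h = record
    { rel  = λ b a → b ∈ app h a
    ; mono = λ {b} {b'} {a} b'≤b a≤a' b∈ha → monotone h a≤a' b' (down (app h a) b'≤b b∈ha) }

  ρ-mono : {A B : Pre} {R S : Rel1 A B} → R ⊑ S → ρ R ≤M ρ S
  ρ-mono {R = R} {S} R⊑S a b b∈ = ∈ρ-intro S a (R⊑S b a (∈ρ-elim R a b∈))

  ρ-◇ : {A B : Pre} (f : Mono A B) → ρ (f ◇) ≐ 𝕪 B ∘M f
  ρ-◇ f a = (λ _ b∈ → b∈) , (λ _ b∈ → b∈)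

  ρ-· : {A B C : Pre} (S : Rel1 B C) (R : Rel1 A B) → ρ (S · R) ≐ 𝕞 C ∘M 𝕃₁ (ρ S) ∘M ρ R
  ρ-· {C = C} S R a = SR⊆ , ⊆SR
    where
      SR⊆ : ∀ c → c ∈ column (S · R) a → c ∈ app (𝕞 C ∘M 𝕃₁ (ρ S) ∘M ρ R) a
      SR⊆ c c∈ = let (b , r , s) = ∈ρ-elim (S · R) a c∈
                 in ∈-𝕞𝕃-intro (ρ S) {column R a} (b , ∈ρ-intro R a r , ∈ρ-intro S b s)
      ⊆SR : ∀ c → c ∈ app (𝕞 C ∘M 𝕃₁ (ρ S) ∘M ρ R) a → c ∈ column (S · R) a
      ⊆SR c c∈ = let (b , b∈ , c∈Sb) = ∈-𝕞𝕃-elim (ρ S) {column R a} c∈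
                 in ∈ρ-intro (S · R) a (b , ∈ρ-elim R a b∈ , ∈ρ-elim S b c∈Sb)

module BCToDistributiveLaw (em : Classical) (F : Functor2) (bc : BeckChevalley F) where
  open Lowersets em
  open LowersetLemmas em
  open Functor2 F
  open FunctorLemmas F
  open BCLemmas F bc

  comprehension : (A : Pre) → Carrier (F₀ (𝕃 A)) → LowerSet (F₀ A)
  comprehension A X = record
    { mem  = λ t → ⟦ app (F₁ (𝕪 A)) t ≤[ F₀ (𝕃 A) ] X ⟧?
    ; down = λ t'≤t t∈ → complete (≤-trans (F₀ (𝕃 A)) (monotone (F₁ (𝕪 A)) t'≤t) (sound t∈)) }

  ∈λ-elim : (A : Pre) (X : Carrier (F₀ (𝕃 A))) {t : Carrier (F₀ A)} →
            t ∈ comprehension A X → app (F₁ (𝕪 A)) t ≤[ F₀ (𝕃 A) ] X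
  ∈λ-elim A X = sound

  ∈λ-intro : (A : Pre) (X : Carrier (F₀ (𝕃 A))) {t : Carrier (F₀ A)} →
             app (F₁ (𝕪 A)) t ≤[ F₀ (𝕃 A) ] X → t ∈ comprehension A X
  ∈λ-intro A X = complete

  λ₀ : (A : Pre) → Mono (F₀ (𝕃 A)) (𝕃 (F₀ A))
  λ₀ A = mkMono (comprehension A)
                (λ X≈Y → shift (≈⇒≤ (F₀ (𝕃 A)) X≈Y) , shift (≈⇒≥ (F₀ (𝕃 A)) X≈Y)) shift
    where
      shift : ∀ {X Y} → X ≤[ F₀ (𝕃 A) ] Y → comprehension A X ≤[ 𝕃 (F₀ A) ] comprehension A Y
      shift {X} {Y} X≤Y t t∈ = ∈λ-intro A Y (≤-trans (F₀ (𝕃 A)) (∈λ-elim A X t∈) X≤Y)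

  -- Unit law: F 𝕪 reflects the order, as 𝕪 does.
  unit : (A : Pre) → λ₀ A ∘M F₁ (𝕪 A) ≐ 𝕪 (F₀ A)
  unit A s =
      (λ t t∈ → ∈𝕪-intro (F₀ A) s (F-reflects (𝕪 A) (𝕪-reflects {A}) (∈λ-elim A (app (F₁ (𝕪 A)) s) t∈)))
    , (λ t t≤s → ∈λ-intro A (app (F₁ (𝕪 A)) s) (monotone (F₁ (𝕪 A)) (∈𝕪-elim (F₀ A) s t≤s)))

  -- Naturality: BC for the exact naturality square of 𝕪 at f.
  natural : {A B : Pre} (f : Mono A B) → λ₀ B ∘M F₁ (𝕃₁ f) ≐ 𝕃₁ (F₁ f) ∘M λ₀ A
  natural {A} {B} f X =
      (λ s s∈ → let (t , s≤Fft , F𝕪t≤X) = to (square s X) (∈λ-elim B (app (F₁ (𝕃₁ f)) X) s∈)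
                in ∈𝕃-intro (F₁ f) (comprehension A X) (t , ∈λ-intro A X F𝕪t≤X , s≤Fft))
    , (λ s s∈ → let (t , t∈ , s≤Fft) = ∈𝕃-elim (F₁ f) (comprehension A X) s∈
                in ∈λ-intro B (app (F₁ (𝕃₁ f)) X) (from (square s X) (t , s≤Fft , ∈λ-elim A X t∈)))
    where
      square : Exact (F₁ f) (F₁ (𝕪 A)) (F₁ (𝕪 B)) (F₁ (𝕃₁ f))
      square = bc f (𝕪 A) (𝕪 B) (𝕃₁ f) (𝕃-lax f) (𝕃-exact f)

  -- Multiplication law.  t ∈ 𝕞 (𝕃 λ (λ Ξ)) iff  F 𝕪 t ≤ Y  for some Y with
  -- F 𝕪 Y ≤ Ξ; such a Y is produced from  F 𝕪 t ≤ F 𝕞 Ξ  by BC for the exact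
  -- square of Elem (split), and conversely  Y ≤ F 𝕞 (F 𝕪 Y)  (join).
  mult : (A : Pre) → λ₀ A ∘M F₁ (𝕞 A) ≐ 𝕞 (F₀ A) ∘M 𝕃₁ (λ₀ A) ∘M λ₀ (𝕃 A)
  mult A Ξ =
      (λ t t∈ → ∈-𝕞𝕃-intro (λ₀ A) {comprehension (𝕃 A) Ξ}
                  (split t (∈λ-elim A (app (F₁ (𝕞 A)) Ξ) t∈)))
    , (λ t t∈ → ∈λ-intro A (app (F₁ (𝕞 A)) Ξ)
                  (join t (∈-𝕞𝕃-elim (λ₀ A) {comprehension (𝕃 A) Ξ} t∈)))
    where
      LA : Pre
      LA = F₀ (𝕃 A)

      split : ∀ t → app (F₁ (𝕪 A)) t ≤[ LA ] app (F₁ (𝕞 A)) Ξ →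
              Σ (Carrier LA) λ Y → Y ∈ comprehension (𝕃 A) Ξ × t ∈ comprehension A Y
      split t F𝕪t≤F𝕞Ξ =
        let (w , t≤Felem , F𝕪set≤Ξ) =
              to (bc element (𝕪 (𝕃 A) ∘M set) (𝕪 A) (𝕞 A) (Elem-lax A) (Elem-exact A) t Ξ) F𝕪t≤F𝕞Ξ
            Y = app (F₁ set) w
        in Y
         , ∈λ-intro (𝕃 A) Ξ (≤-trans (F₀ (𝕃 (𝕃 A)))
                               (≈⇒≥ (F₀ (𝕃 (𝕃 A))) (F-∘ (𝕪 (𝕃 A)) set w))
                               F𝕪set≤Ξ)
         , ∈λ-intro A Y (≤-trans LA (monotone (F₁ (𝕪 A)) t≤Felem)
                                    (F-∘≤ (𝕪 A) element set 𝕪-element≤set w))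

      join : ∀ t → (Σ (Carrier LA) λ Y → Y ∈ comprehension (𝕃 A) Ξ × t ∈ comprehension A Y) →
             app (F₁ (𝕪 A)) t ≤[ LA ] app (F₁ (𝕞 A)) Ξ
      join t (Y , Y∈ , t∈) =
        ≤-trans LA (∈λ-elim A Y t∈)
          (≤-trans LA (F-id≥ Y)
            (≤-trans LA (F-≤∘ (𝕞 A) (𝕪 (𝕃 A)) (idM (𝕃 A)) 𝕞-𝕪-unit Y)
                        (monotone (F₁ (𝕞 A)) (∈λ-elim (𝕃 A) Ξ Y∈))))

  BC⇒distributiveLaw : DistributiveLaw F
  BC⇒distributiveLaw = record { λ₀ = λ₀ ; natural = natural ; unit = unit ; mult = mult }

module DistributiveLawToExtension (em : Classical) (F : Functor2)
                                  (D : Lowersets.DistributiveLaw em F) where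
  open Lowersets em
  open LowersetLemmas em
  open Functor2 F
  open FunctorLemmas F
  open DistributiveLaw D

  Λ : {A B : Pre} → Rel1 A B → Mono (F₀ A) (𝕃 (F₀ B))
  Λ {B = B} R = λ₀ B ∘M F₁ (ρ R)

  T̄₁ : {A B : Pre} → Rel1 A B → Rel1 (F₀ A) (F₀ B)
  T̄₁ R = toRel (Λ R)

  T̄-mono : {A B : Pre} {R S : Rel1 A B} → R ⊑ S → T̄₁ R ⊑ T̄₁ S
  T̄-mono {B = B} {R} {S} R⊑S y x = monotone (λ₀ B) (F-mono (ρ-mono {R = R} {S} R⊑S) x) y

  Λ-◇ : {A B : Pre} (f : Mono A B) (x : Carrier (F₀ A)) →
        Preorder._≈_ (𝕃 (F₀ B)) (app (Λ (f ◇)) x) (app (𝕪 (F₀ B)) (app (F₁ f) x))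
  Λ-◇ {B = B} f x = begin
    app (λ₀ B) (app (F₁ (ρ (f ◇))) x)           ≈⟨ resp (λ₀ B) (F-resp (ρ-◇ f) x) ⟩
    app (λ₀ B) (app (F₁ (𝕪 B ∘M f)) x)          ≈⟨ resp (λ₀ B) (F-∘ (𝕪 B) f x) ⟩
    app (λ₀ B) (app (F₁ (𝕪 B)) (app (F₁ f) x))  ≈⟨ unit B (app (F₁ f) x) ⟩
    app (𝕪 (F₀ B)) (app (F₁ f) x)               ∎
    where open SetoidReasoning (Preorder.Eq.setoid (𝕃 (F₀ B)))

  T̄-◇ : {A B : Pre} (f : Mono A B) → T̄₁ (f ◇) ≅R F₁ f ◇
  T̄-◇ {B = B} f =
      (λ y x y∈ → ∈𝕪-elim (F₀ B) (app (F₁ f) x) (proj₁ (Λ-◇ f x) y y∈))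
    , (λ y x y≤Ffx → proj₂ (Λ-◇ f x) y (∈𝕪-intro (F₀ B) (app (F₁ f) x) y≤Ffx))

  Λ-· : {A B C : Pre} (S : Rel1 B C) (R : Rel1 A B) (x : Carrier (F₀ A)) →
        Preorder._≈_ (𝕃 (F₀ C)) (app (Λ (S · R)) x)
          (app (𝕞 (F₀ C)) (app (𝕃₁ (λ₀ C)) (app (𝕃₁ (F₁ (ρ S))) (app (Λ R) x))))
  Λ-· {C = C} S R x = begin
    app (λ₀ C) (app (F₁ (ρ (S · R))) x)
      ≈⟨ resp (λ₀ C) (Preorder.Eq.trans (F₀ (𝕃 C)) (F-resp (ρ-· S R) x)
                                                    (F-∘₃ (𝕞 C) (𝕃₁ (ρ S)) (ρ R) x)) ⟩
    app (λ₀ C) (app (F₁ (𝕞 C)) V)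
      ≈⟨ mult C V ⟩
    app (𝕞 (F₀ C)) (app (𝕃₁ (λ₀ C)) (app (λ₀ (𝕃 C)) V))
      ≈⟨ resp (𝕞 (F₀ C) ∘M 𝕃₁ (λ₀ C)) {app (λ₀ (𝕃 C)) V} {app (𝕃₁ (F₁ (ρ S))) (app (Λ R) x)}
              (natural (ρ S) (app (F₁ (ρ R)) x)) ⟩
    app (𝕞 (F₀ C)) (app (𝕃₁ (λ₀ C)) (app (𝕃₁ (F₁ (ρ S))) (app (Λ R) x)))
      ∎
    where
      open SetoidReasoning (Preorder.Eq.setoid (𝕃 (F₀ C)))
      V : Carrier (F₀ (𝕃 (𝕃 C)))
      V = app (F₁ (𝕃₁ (ρ S))) (app (F₁ (ρ R)) x)

  T̄-· : {A B C : Pre} (S : Rel1 B C) (R : Rel1 A B) → T̄₁ (S · R) ≅R T̄₁ S · T̄₁ R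
  T̄-· {C = C} S R =
      (λ z x z∈ → ∈-𝕞𝕃𝕃-elim (λ₀ C) (F₁ (ρ S)) {app (Λ R) x} (proj₁ (Λ-· S R x) z z∈))
    , (λ z x witness → proj₂ (Λ-· S R x) z (∈-𝕞𝕃𝕃-intro (λ₀ C) (F₁ (ρ S)) {app (Λ R) x} witness))

  distributiveLaw⇒extension : RelExtension F
  distributiveLaw⇒extension =
    mkRelExtension F T̄₁ (λ {A} {B} {R} {S} → T̄-mono {A} {B} {R} {S}) T̄-· T̄-◇

theorem5p3 : (em : Classical) (T : Functor2) →
    (RelExtension T ⇔ BeckChevalley T)
    × (BeckChevalley T ⇔ Lowersets.DistributiveLaw em T)
theorem5p3 em F =
    mk⇔ (ExtensionToBC.extension⇒BC F) (BCToExtension.BC⇒extension F)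
  , mk⇔ (BCToDistributiveLaw.BC⇒distributiveLaw em F)
        (λ D → ExtensionToBC.extension⇒BC F
                 (DistributiveLawToExtension.distributiveLaw⇒extension em F D))
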